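{- Let $a,c$ be the automorphisms of the ternary tree $\{0,1,2\}^*$ (acting also on infinite words over $\{0,1,2\}$) defined as follows: $a$ changes the first occurrence in the word of either letter $0$ or $1$ into the other of these two letters (and does nothing if neither occurs), and $c$ does the same for the letters $1$ and $2$. Define matrices $K_n$ of size $3^n\times n$ with entries in $\{0,1,2\}$ by \[K_1=\begin{bmatrix}0\\1\\2\end{bmatrix},\qquad K_{n+1}=\begin{bmatrix}K_n & 0_n\\ K_n^R & 1_n\\ K_n & 2_n\end{bmatrix},\] where $K_n^R$ is $K_n$ with its rows in reverse order and $0_n,1_n,2_n$ are columns of $3^n$ entries equal to $0,1,2$ respectively. Since $K_n$ is the upper left corner of $K_{n+1}$, the limit $K=\lim_n K_n$ is a well-defined infinite matrix; let $k_i$ ($i\ge0$) denote its $i$-th row, an infinite word over $\{0,1,2\}$ (the first column giving the first letter). For $j\ge0$ let $t_{2j}=(ca)^j$ and $t_{2j+1}=a(ca)^j$ (composition right to left, so $t_1=a$, $t_2=ca$). Then $k_i=t_i(k_0)$ for all $i\ge0$.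
   Context: Rows of $K$ are indexed starting from $0$; $k_0=000\dots$. -}

module Defs where

open import Data.Nat using (NonZero; ℕ; zero; suc; _+_; _∸_; _^_; _/_; _%_; _<ᵇ_; _≡ᵇ_)
open import Data.Fin using (Fin)
open import Data.Bool using (Bool; true; false; if_then_else_; _∧_; not)
open import Data.Nat.Properties using (m^n≢0)
open import Function using (id; _∘_)

Word : Set
Word = ℕ → Fin 3

l0 l1 l2 : Fin 3
l0 = Fin.zero
l1 = Fin.suc Fin.zero
l2 = Fin.suc (Fin.suc Fin.zero)

-- the letter with value q (q is always < 3 where it is used)
toLetter : ℕ → Fin 3
toLetter zero = l0
toLetter (suc zero) = l1
toLetter (suc (suc _)) = l2

is01 : Fin 3 → Bool
is01 Fin.zero = true
is01 (Fin.suc Fin.zero) = true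
is01 (Fin.suc (Fin.suc _)) = false

is12 : Fin 3 → Bool
is12 Fin.zero = false
is12 (Fin.suc _) = true

swap01 : Fin 3 → Fin 3
swap01 Fin.zero = l1
swap01 (Fin.suc Fin.zero) = l0
swap01 (Fin.suc (Fin.suc x)) = Fin.suc (Fin.suc x)

swap12 : Fin 3 → Fin 3
swap12 Fin.zero = l0
swap12 (Fin.suc Fin.zero) = l2
swap12 (Fin.suc (Fin.suc _)) = l1

noneBefore : (Fin 3 → Bool) → Word → ℕ → Bool
noneBefore p w zero = true
noneBefore p w (suc n) = noneBefore p w n ∧ not (p (w n))

changeFirst : (Fin 3 → Bool) → (Fin 3 → Fin 3) → Word → Word
changeFirst p s w n = if p (w n) ∧ noneBefore p w n then s (w n) else w n

a : Word → Word
a = changeFirst is01 swap01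

c : Word → Word
c = changeFirst is12 swap12

caPow : ℕ → Word → Word
caPow zero = id
caPow (suc j) = c ∘ a ∘ caPow j

t : ℕ → Word → Word
t i = if i % 2 ≡ᵇ 0 then caPow (i / 2) else a ∘ caPow (i / 2)

-- Kmat n r j : entry (row r, column j) of K_n  (n ≥ 1; rows 0..3^n-1,
-- columns 0..n-1; values outside that range are irrelevant junk).
Kmat : ℕ → ℕ → ℕ → Fin 3
Kmat zero r j = l0
Kmat (suc zero) r j = toLetter r
Kmat (suc (suc n)) r j =
  if j <ᵇ suc n
  then (if q ≡ᵇ 1 then Kmat (suc n) (3 ^ suc n ∸ 1 ∸ r') j
                  else Kmat (suc n) r' j)
  else toLetter q
  where
  instance
    nz : NonZero (3 ^ suc n)
    nz = m^n≢0 3 (suc n)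
  q  = r / (3 ^ suc n)
  r' = r % (3 ^ suc n)

-- rows of the limit matrix K: entry (i , j) read off from K_{i+j+1},
-- which contains row i (i < 3^(i+j+1)) and column j (j < i+j+1).
k : ℕ → Word
k i j = Kmat (suc (i + j)) i j

{-# OPTIONS --safe #-}
-- Row i of K is the reflected ternary Gray code of i. Since 3^n is odd, adding q·3^n to a row
-- index i < 3^n mirrors (0 ↔ 2) the first n letters of its Gray code iff q is odd, and so does
-- replacing i by 3^n − 1 − i; this is exactly the block recursion defining K_(n+1).
-- Passing from i to i + 1 changes the Gray code as a does when i is even and as c when i is odd:
-- the lowest digit d becomes d + 1, which is one swap of the first letter, unless d = 2; then the
-- first letter is the one the swap ignores (2 for a, 0 for c) and the increment carries into
-- ⌊i / 3⌋, which has the same parity as i. Hence k_(i+1) is alternately a k_i and c k_i.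
module Submission where

open import Defs
open import Data.Nat using (ℕ)
open import Relation.Binary.PropositionalEquality using (_≗_)

open import Data.Bool using (true; false; if_then_else_; _∧_; not)
open import Data.Bool.Properties using (∧-zeroʳ; T-≡)
open import Data.Fin using (Fin)
open import Data.Nat using (zero; suc; _+_; _*_; _∸_; _^_; _/_; _%_; _<ᵇ_; _≡ᵇ_; _≤_; _<_; z≤n; s≤s; z<s; NonZero; parity)
open import Data.Nat.DivMod
open import Data.Nat.Divisibility using (n∣m*n)
open import Data.Nat.Properties
open import Data.Nat.Tactic.RingSolver using (solve-∀)
open import Data.Parity.Base using (Parity; 0ℙ; 1ℙ; _⁻¹) renaming (_+_ to _+ℙ_; _*_ to _*ℙ_)
import Data.Parity.Properties as ℙ
open import Data.Product using (_,_)
open import Data.Sum using (inj₁; inj₂)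
open import Function using (id; _∘_)
open import Function.Bundles using (Equivalence)
open import Relation.Binary.PropositionalEquality
open ≡-Reasoning

[m+kn]/n≡m/n+k : ∀ m k n .{{_ : NonZero n}} → (m + k * n) / n ≡ m / n + k
[m+kn]/n≡m/n+k m k n = trans (+-distrib-/-∣ʳ m (n∣m*n k)) (cong (m / n +_) (m*n/n≡m k n))

m<3n⇒m/3<n : ∀ {m n} → m < 3 * n → m / 3 < n
m<3n⇒m/3<n {m} {n} m<3n = m<n*o⇒m/o<n (subst (m <_) (*-comm 3 n) m<3n)

n<3^n : ∀ n → n < 3 ^ n
n<3^n zero = z<s
n<3^n (suc n) = ≤-trans (+-mono-≤ (m^n>0 3 n) (n<3^n n)) (+-monoʳ-≤ (3 ^ n) (m≤m+n (3 ^ n) _))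

k*3^[1+m]≡k*3^m*3 : ∀ k m → k * 3 ^ suc m ≡ k * 3 ^ m * 3
k*3^[1+m]≡k*3^m*3 k m = trans (cong (k *_) (*-comm 3 (3 ^ m))) (sym (*-assoc k (3 ^ m) 3))

<ᵇ-irrefl : ∀ n → (n <ᵇ n) ≡ false
<ᵇ-irrefl zero = refl
<ᵇ-irrefl (suc n) = <ᵇ-irrefl n

<⇒<ᵇ≡true : ∀ {m n} → m < n → (m <ᵇ n) ≡ true
<⇒<ᵇ≡true m<n = Equivalence.to T-≡ (<⇒<ᵇ m<n)

3n∸[1+m]≡digits : ∀ n m → m < 3 * n → 3 * n ∸ suc m ≡ 2 ∸ m % 3 + (n ∸ suc (m / 3)) * 3
3n∸[1+m]≡digits n m m<3n with m≤n⇒∃[o]m+o≡n {suc (m / 3)} {n} (m<3n⇒m/3<n m<3n)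
... | v , refl = begin
    3 * (suc u + v) ∸ suc m
  ≡⟨ cong (λ x → 3 * (suc u + v) ∸ suc x) (m≡m%n+[m/n]*n m 3) ⟩
    3 * (suc u + v) ∸ suc (d + u * 3)
  ≡⟨ cong (_∸ suc (d + u * 3)) split ⟩
    suc (d + u * 3) + (2 ∸ d + v * 3) ∸ suc (d + u * 3)
  ≡⟨ m+n∸m≡n (suc (d + u * 3)) _ ⟩
    2 ∸ d + v * 3
  ≡⟨ cong (λ x → 2 ∸ d + x * 3) (m+n∸m≡n (suc u) v) ⟨
    2 ∸ d + (suc u + v ∸ suc u) * 3
  ∎
  where
  d = m % 3
  u = m / 3
  split : 3 * (suc u + v) ≡ suc (d + u * 3) + (2 ∸ d + v * 3)
  split = begin
      3 * (suc u + v)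
    ≡⟨ expand u v ⟩
      suc (2 + (u + v) * 3)
    ≡⟨ cong (λ x → suc (x + (u + v) * 3)) (m+[n∸m]≡n (≤-pred (m%n<n m 3))) ⟨
      suc (d + (2 ∸ d) + (u + v) * 3)
    ≡⟨ rearrange d (2 ∸ d) u v ⟩
      suc (d + u * 3) + (2 ∸ d + v * 3)
    ∎
    where
    expand : ∀ u v → 3 * (suc u + v) ≡ suc (2 + (u + v) * 3)
    expand = solve-∀
    rearrange : ∀ d e u v → suc (d + e + (u + v) * 3) ≡ suc (d + u * 3) + (e + v * 3)
    rearrange = solve-∀

parity-suc : ∀ n → parity (suc n) ≡ parity n ⁻¹
parity-suc = ℙ.+-homo-+ 1

parity-3^ : ∀ m → parity (3 ^ m) ≡ 1ℙ
parity-3^ zero = refl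
parity-3^ (suc m) = trans (ℙ.*-homo-* 3 (3 ^ m)) (parity-3^ m)

parity-+-*odd : ∀ m n {o} → parity o ≡ 1ℙ → parity (m + n * o) ≡ parity m +ℙ parity n
parity-+-*odd m n {o} odd = begin
    parity (m + n * o)
  ≡⟨ ℙ.+-homo-+ m (n * o) ⟩
    parity m +ℙ parity (n * o)
  ≡⟨ cong (parity m +ℙ_) (ℙ.*-homo-* n o) ⟩
    parity m +ℙ (parity n *ℙ parity o)
  ≡⟨ cong (λ p → parity m +ℙ (parity n *ℙ p)) odd ⟩
    parity m +ℙ (parity n *ℙ 1ℙ)
  ≡⟨ cong (parity m +ℙ_) (ℙ.*-identityʳ (parity n)) ⟩
    parity m +ℙ parity n
  ∎

parity-*2 : ∀ m → parity (m * 2) ≡ 0ℙ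
parity-*2 m = trans (ℙ.*-homo-* m 2) (ℙ.*-zeroʳ (parity m))

parity-∸-suc : ∀ n m → parity n ≡ 1ℙ → m < n → parity (n ∸ suc m) ≡ parity m
parity-∸-suc n m odd m<n with m≤n⇒∃[o]m+o≡n {suc m} {n} m<n
... | v , refl rewrite m+n∸m≡n (suc m) v =
  cancel (parity m) (parity v) (trans (cong _⁻¹ (sym (ℙ.+-homo-+ m v))) (trans (sym (parity-suc (m + v))) odd))
  where
  cancel : ∀ p q → (p +ℙ q) ⁻¹ ≡ 1ℙ → q ≡ p
  cancel 0ℙ 0ℙ _ = refl
  cancel 1ℙ 1ℙ _ = refl

mirror : Fin 3 → Fin 3
mirror Fin.zero = l2
mirror (Fin.suc Fin.zero) = l1
mirror (Fin.suc (Fin.suc _)) = l0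

mirror-involutive : ∀ x → mirror (mirror x) ≡ x
mirror-involutive Fin.zero = refl
mirror-involutive (Fin.suc Fin.zero) = refl
mirror-involutive (Fin.suc (Fin.suc Fin.zero)) = refl

mirrorIf : Parity → Fin 3 → Fin 3
mirrorIf 0ℙ = id
mirrorIf 1ℙ = mirror

mirrorIf-+ : ∀ p q x → mirrorIf (p +ℙ q) x ≡ mirrorIf q (mirrorIf p x)
mirrorIf-+ 0ℙ q x = refl
mirrorIf-+ 1ℙ 0ℙ x = refl
mirrorIf-+ 1ℙ 1ℙ x = sym (mirror-involutive x)

mirrorIf-mirror : ∀ p x → mirrorIf p (mirror x) ≡ mirror (mirrorIf p x)
mirrorIf-mirror 0ℙ x = refl
mirrorIf-mirror 1ℙ x = refl

toLetter-2∸ : ∀ {d} → d < 3 → toLetter (2 ∸ d) ≡ mirror (toLetter d)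
toLetter-2∸ {0} _ = refl
toLetter-2∸ {1} _ = refl
toLetter-2∸ {2} _ = refl
toLetter-2∸ {suc (suc (suc _))} (s≤s (s≤s (s≤s ())))

infixr 5 _∷_
_∷_ : Fin 3 → Word → Word
(x ∷ w) zero = x
(x ∷ w) (suc n) = w n

noneBefore-cong : ∀ p {w w′} → w ≗ w′ → ∀ n → noneBefore p w n ≡ noneBefore p w′ n
noneBefore-cong p w≗w′ zero = refl
noneBefore-cong p w≗w′ (suc n) = cong₂ (λ b x → b ∧ not (p x)) (noneBefore-cong p w≗w′ n) (w≗w′ n)

changeFirst-cong : ∀ p s {w w′} → w ≗ w′ → changeFirst p s w ≗ changeFirst p s w′
changeFirst-cong p s w≗w′ n rewrite w≗w′ n | noneBefore-cong p w≗w′ n = refl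

noneBefore-∷-hit : ∀ p {x} w → p x ≡ true → ∀ n → noneBefore p (x ∷ w) (suc n) ≡ false
noneBefore-∷-hit p w px zero rewrite px = refl
noneBefore-∷-hit p w px (suc n) rewrite noneBefore-∷-hit p w px n = refl

noneBefore-∷-miss : ∀ p {x} w → p x ≡ false → ∀ n → noneBefore p (x ∷ w) (suc n) ≡ noneBefore p w n
noneBefore-∷-miss p w px zero rewrite px = refl
noneBefore-∷-miss p w px (suc n) rewrite noneBefore-∷-miss p w px n = refl

changeFirst-∷-hit : ∀ p s {x} w → p x ≡ true → changeFirst p s (x ∷ w) ≗ (s x ∷ w)
changeFirst-∷-hit p s w px zero rewrite px = refl
changeFirst-∷-hit p s w px (suc n) rewrite noneBefore-∷-hit p w px n | ∧-zeroʳ (p (w n)) = refl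

changeFirst-∷-miss : ∀ p s {x} w → p x ≡ false → changeFirst p s (x ∷ w) ≗ (x ∷ changeFirst p s w)
changeFirst-∷-miss p s w px zero rewrite px = refl
changeFirst-∷-miss p s w px (suc n) rewrite noneBefore-∷-miss p w px n = refl

next : Parity → Word → Word
next 0ℙ = a
next 1ℙ = c

next-cong : ∀ p {w w′} → w ≗ w′ → next p w ≗ next p w′
next-cong 0ℙ = changeFirst-cong is01 swap01
next-cong 1ℙ = changeFirst-cong is12 swap12

-- Letter j is the j-th base-3 digit of i, mirrored when ⌊i / 3^(j+1)⌋ is odd.
gray : ℕ → Word
gray i zero = mirrorIf (parity (i / 3)) (toLetter (i % 3))
gray i (suc j) = gray (i / 3) j

gray-letter : ∀ {q} → q < 3 → gray q 0 ≡ toLetter q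
gray-letter {0} _ = refl
gray-letter {1} _ = refl
gray-letter {2} _ = refl
gray-letter {suc (suc (suc _))} (s≤s (s≤s (s≤s ())))

gray-+-*3 : ∀ m n → gray (m + n * 3) ≗ (mirrorIf (parity (m / 3 + n)) (toLetter (m % 3)) ∷ gray (m / 3 + n))
gray-+-*3 m n zero =
  cong₂ (λ q r → mirrorIf (parity q) (toLetter r)) ([m+kn]/n≡m/n+k m n 3) ([m+kn]%n≡m%n m n 3)
gray-+-*3 m n (suc j) = cong (λ q → gray q j) ([m+kn]/n≡m/n+k m n 3)

gray-digit : ∀ {d} n → d < 3 → gray (d + n * 3) ≗ (mirrorIf (parity n) (toLetter d) ∷ gray n)
gray-digit {d} n d<3 j = begin
    gray (d + n * 3) j
  ≡⟨ gray-+-*3 d n j ⟩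
    (mirrorIf (parity (d / 3 + n)) (toLetter (d % 3)) ∷ gray (d / 3 + n)) j
  ≡⟨ cong₂ (λ q r → (mirrorIf (parity (q + n)) (toLetter r) ∷ gray (q + n)) j) (m<n⇒m/n≡0 d<3) (m<n⇒m%n≡m d<3) ⟩
    (mirrorIf (parity n) (toLetter d) ∷ gray n) j
  ∎

gray-+-*3^suc : ∀ m q n → gray (m + q * 3 ^ suc n) ≗
  (mirrorIf (parity (m / 3 + q * 3 ^ n)) (toLetter (m % 3)) ∷ gray (m / 3 + q * 3 ^ n))
gray-+-*3^suc m q n j =
  trans (cong (λ x → gray (m + x) j) (k*3^[1+m]≡k*3^m*3 q n)) (gray-+-*3 m (q * 3 ^ n) j)

gray-+-*3^ : ∀ {j n} m q → j < n → gray (m + q * 3 ^ n) j ≡ mirrorIf (parity q) (gray m j)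
gray-+-*3^ {zero} {suc n} m q _ = begin
    gray (m + q * 3 ^ suc n) 0
  ≡⟨ gray-+-*3^suc m q n 0 ⟩
    mirrorIf (parity (m / 3 + q * 3 ^ n)) (toLetter (m % 3))
  ≡⟨ cong (λ p → mirrorIf p (toLetter (m % 3))) (parity-+-*odd (m / 3) q (parity-3^ n)) ⟩
    mirrorIf (parity (m / 3) +ℙ parity q) (toLetter (m % 3))
  ≡⟨ mirrorIf-+ (parity (m / 3)) (parity q) _ ⟩
    mirrorIf (parity q) (gray m 0)
  ∎
gray-+-*3^ {suc j} {suc n} m q (s≤s j<n) =
  trans (gray-+-*3^suc m q n (suc j)) (gray-+-*3^ (m / 3) q j<n)

gray-+-*3^-top : ∀ n {m} q → m < 3 ^ n → gray (m + q * 3 ^ n) n ≡ gray q 0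
gray-+-*3^-top zero {zero} q _ = cong (λ x → gray x 0) (*-identityʳ q)
gray-+-*3^-top zero {suc _} q (s≤s ())
gray-+-*3^-top (suc n) {m} q m<3^n =
  trans (gray-+-*3^suc m q n (suc n)) (gray-+-*3^-top n q (m<3n⇒m/3<n m<3^n))

gray-complement-digits : ∀ n m → m < 3 ^ suc n →
  gray (3 ^ suc n ∸ suc m) ≗ (mirror (gray m 0) ∷ gray (3 ^ n ∸ suc (m / 3)))
gray-complement-digits n m m<3^n j = begin
    gray (3 ^ suc n ∸ suc m) j
  ≡⟨ cong (λ x → gray x j) (3n∸[1+m]≡digits (3 ^ n) m m<3^n) ⟩
    gray (2 ∸ m % 3 + w * 3) j
  ≡⟨ gray-digit w (s≤s (m∸n≤m 2 (m % 3))) j ⟩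
    (mirrorIf (parity w) (toLetter (2 ∸ m % 3)) ∷ gray w) j
  ≡⟨ cong (λ x → (x ∷ gray w) j) first-letter ⟩
    (mirror (gray m 0) ∷ gray w) j
  ∎
  where
  w = 3 ^ n ∸ suc (m / 3)
  first-letter : mirrorIf (parity w) (toLetter (2 ∸ m % 3)) ≡ mirror (gray m 0)
  first-letter = begin
      mirrorIf (parity w) (toLetter (2 ∸ m % 3))
    ≡⟨ cong₂ mirrorIf (parity-∸-suc (3 ^ n) (m / 3) (parity-3^ n) (m<3n⇒m/3<n m<3^n))
                      (toLetter-2∸ (m%n<n m 3)) ⟩
      mirrorIf (parity (m / 3)) (mirror (toLetter (m % 3)))
    ≡⟨ mirrorIf-mirror (parity (m / 3)) _ ⟩
      mirror (gray m 0)
    ∎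

gray-complement : ∀ {j n} m → j < n → m < 3 ^ n → gray (3 ^ n ∸ suc m) j ≡ mirror (gray m j)
gray-complement {zero} {suc n} m _ m<3^n = gray-complement-digits n m m<3^n 0
gray-complement {suc j} {suc n} m (s≤s j<n) m<3^n =
  trans (gray-complement-digits n m m<3^n (suc j)) (gray-complement (m / 3) j<n (m<3n⇒m/3<n m<3^n))

Kmat-gray : ∀ n {r j} → r < 3 ^ suc n → j ≤ n → Kmat (suc n) r j ≡ gray r j
Kmat-gray zero {r} {zero} r<3 z≤n = sym (gray-letter r<3)
Kmat-gray (suc n) {r} {j} r<3N j≤1+n = begin
    Kmat (suc (suc n)) r j
  ≡⟨ block-entry j≤1+n (m<n*o⇒m/o<n r<3N) (m%n<n r N) ⟩
    gray (r % N + r / N * N) j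
  ≡⟨ cong (λ x → gray x j) (m≡m%n+[m/n]*n r N) ⟨
    gray r j
  ∎
  where
  N = 3 ^ suc n
  instance
    N≢0 : NonZero N
    N≢0 = m^n≢0 3 (suc n)

  inherited-column : ∀ {j} q {r′} → q < 3 → r′ < N → j ≤ n →
    (if q ≡ᵇ 1 then Kmat (suc n) (N ∸ 1 ∸ r′) j else Kmat (suc n) r′ j) ≡ gray (r′ + q * N) j
  inherited-column 0 _ r′<N j≤n = trans (Kmat-gray n r′<N j≤n) (sym (gray-+-*3^ _ 0 (s≤s j≤n)))
  inherited-column {j} 1 {r′} _ r′<N j≤n = begin
      Kmat (suc n) (N ∸ 1 ∸ r′) j
    ≡⟨ cong (λ x → Kmat (suc n) x j) (∸-+-assoc N 1 r′) ⟩
      Kmat (suc n) (N ∸ suc r′) j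
    ≡⟨ Kmat-gray n (∸-monoʳ-< z<s r′<N) j≤n ⟩
      gray (N ∸ suc r′) j
    ≡⟨ gray-complement r′ (s≤s j≤n) r′<N ⟩
      mirror (gray r′ j)
    ≡⟨ gray-+-*3^ r′ 1 (s≤s j≤n) ⟨
      gray (r′ + 1 * N) j
    ∎
  inherited-column 2 _ r′<N j≤n = trans (Kmat-gray n r′<N j≤n) (sym (gray-+-*3^ _ 2 (s≤s j≤n)))
  inherited-column (suc (suc (suc _))) (s≤s (s≤s (s≤s ()))) _ _

  block-entry : ∀ {j q r′} → j ≤ suc n → q < 3 → r′ < N →
    (if j <ᵇ suc n
     then (if q ≡ᵇ 1 then Kmat (suc n) (N ∸ 1 ∸ r′) j else Kmat (suc n) r′ j)
     else toLetter q)
    ≡ gray (r′ + q * N) j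
  block-entry {j} {q} j≤1+n q<3 r′<N with m≤n⇒m<n∨m≡n j≤1+n
  ... | inj₁ (s≤s j≤n) rewrite <⇒<ᵇ≡true (s≤s j≤n) = inherited-column _ q<3 r′<N j≤n
  ... | inj₂ refl rewrite <ᵇ-irrefl (suc n) =
    sym (trans (gray-+-*3^-top (suc n) q r′<N) (gray-letter q<3))

k-gray : ∀ i → k i ≗ gray i
k-gray i j = Kmat-gray (i + j) i<3^[1+i+j] (m≤n+m j i)
  where
  i<3^[1+i+j] : i < 3 ^ suc (i + j)
  i<3^[1+i+j] = <-≤-trans (n<3^n i) (^-monoʳ-≤ 3 (≤-trans (m≤m+n i j) (n≤1+n (i + j))))

next-increment : ∀ {d} p w → d < 2 →
  next (parity d +ℙ p) (mirrorIf p (toLetter d) ∷ w) ≗ (mirrorIf p (toLetter (suc d)) ∷ w)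
next-increment {0} 0ℙ w _ = changeFirst-∷-hit is01 swap01 w refl
next-increment {0} 1ℙ w _ = changeFirst-∷-hit is12 swap12 w refl
next-increment {1} 0ℙ w _ = changeFirst-∷-hit is12 swap12 w refl
next-increment {1} 1ℙ w _ = changeFirst-∷-hit is01 swap01 w refl
next-increment {suc (suc _)} _ _ (s≤s (s≤s ()))

next-skip : ∀ p w → next p (mirrorIf p l2 ∷ w) ≗ (mirrorIf p l2 ∷ next p w)
next-skip 0ℙ w = changeFirst-∷-miss is01 swap01 w refl
next-skip 1ℙ w = changeFirst-∷-miss is12 swap12 w refl

next-gray-digit : ∀ {d} n → d < 3 →
  next (parity (d + n * 3)) (gray (d + n * 3)) ≗ next (parity d +ℙ parity n) (mirrorIf (parity n) (toLetter d) ∷ gray n)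
next-gray-digit {d} n d<3 j = begin
    next (parity (d + n * 3)) (gray (d + n * 3)) j
  ≡⟨ cong (λ p → next p (gray (d + n * 3)) j) (parity-+-*odd d n refl) ⟩
    next (parity d +ℙ parity n) (gray (d + n * 3)) j
  ≡⟨ next-cong (parity d +ℙ parity n) (gray-digit n d<3) j ⟩
    next (parity d +ℙ parity n) (mirrorIf (parity n) (toLetter d) ∷ gray n) j
  ∎

gray-suc-no-carry : ∀ {d} n j → d < 2 → gray (suc (d + n * 3)) j ≡ next (parity (d + n * 3)) (gray (d + n * 3)) j
gray-suc-no-carry {d} n j d<2 = begin
    gray (suc d + n * 3) j
  ≡⟨ gray-digit n (s≤s d<2) j ⟩
    (mirrorIf (parity n) (toLetter (suc d)) ∷ gray n) j
  ≡⟨ next-increment (parity n) (gray n) d<2 j ⟨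
    next (parity d +ℙ parity n) (mirrorIf (parity n) (toLetter d) ∷ gray n) j
  ≡⟨ next-gray-digit n (≤-trans d<2 (n≤1+n 2)) j ⟨
    next (parity (d + n * 3)) (gray (d + n * 3)) j
  ∎

-- Induction on the position j: a carry passes to letter j - 1 of gray (suc (i / 3)).
mutual
  gray-suc : ∀ j i → gray (suc i) j ≡ next (parity i) (gray i) j
  gray-suc j i = subst (λ i → gray (suc i) j ≡ next (parity i) (gray i) j) (sym (m≡m%n+[m/n]*n i 3))
    (by-digit (i % 3) (m%n<n i 3))
    where
    by-digit : ∀ d → d < 3 → gray (suc (d + i / 3 * 3)) j ≡ next (parity (d + i / 3 * 3)) (gray (d + i / 3 * 3)) j
    by-digit 0 _ = gray-suc-no-carry (i / 3) j (s≤s z≤n)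
    by-digit 1 _ = gray-suc-no-carry (i / 3) j (s≤s (s≤s z≤n))
    by-digit 2 _ = gray-suc-carry j (i / 3)
    by-digit (suc (suc (suc _))) (s≤s (s≤s (s≤s ())))

  gray-suc-carry : ∀ j n → gray (suc n * 3) j ≡ next (parity (2 + n * 3)) (gray (2 + n * 3)) j
  gray-suc-carry zero n = begin
      gray (suc n * 3) 0
    ≡⟨ gray-digit (suc n) z<s 0 ⟩
      mirrorIf (parity (suc n)) l0
    ≡⟨ cong (λ p → mirrorIf p l0) (parity-suc n) ⟩
      mirrorIf (1ℙ +ℙ parity n) l0
    ≡⟨ mirrorIf-+ 1ℙ (parity n) l0 ⟩
      mirrorIf (parity n) l2
    ≡⟨ next-skip (parity n) (gray n) 0 ⟨
      next (parity n) (mirrorIf (parity n) l2 ∷ gray n) 0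
    ≡⟨ next-gray-digit n (s≤s (s≤s (s≤s z≤n))) 0 ⟨
      next (parity (2 + n * 3)) (gray (2 + n * 3)) 0
    ∎
  gray-suc-carry (suc j) n = begin
      gray (suc n * 3) (suc j)
    ≡⟨ gray-digit (suc n) z<s (suc j) ⟩
      gray (suc n) j
    ≡⟨ gray-suc j n ⟩
      next (parity n) (gray n) j
    ≡⟨ next-skip (parity n) (gray n) (suc j) ⟨
      next (parity n) (mirrorIf (parity n) l2 ∷ gray n) (suc j)
    ≡⟨ next-gray-digit n (s≤s (s≤s (s≤s z≤n))) (suc j) ⟨
      next (parity (2 + n * 3)) (gray (2 + n * 3)) (suc j)
    ∎

k-suc : ∀ i → k (suc i) ≗ next (parity i) (k i)
k-suc i j = begin
    k (suc i) j
  ≡⟨ k-gray (suc i) j ⟩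
    gray (suc i) j
  ≡⟨ gray-suc j i ⟩
    next (parity i) (gray i) j
  ≡⟨ next-cong (parity i) (k-gray i) j ⟨
    next (parity i) (k i) j
  ∎

mutual
  k-even : ∀ m → k (m * 2) ≗ caPow m (k 0)
  k-even zero j = refl
  k-even (suc m) j = begin
      k (suc (suc (m * 2))) j
    ≡⟨ k-suc (suc (m * 2)) j ⟩
      next (parity (suc (m * 2))) (k (suc (m * 2))) j
    ≡⟨ cong (λ p → next p (k (suc (m * 2))) j) (trans (parity-suc (m * 2)) (cong _⁻¹ (parity-*2 m))) ⟩
      c (k (suc (m * 2))) j
    ≡⟨ next-cong 1ℙ (k-odd m) j ⟩
      c (a (caPow m (k 0))) j
    ∎

  k-odd : ∀ m → k (suc (m * 2)) ≗ a (caPow m (k 0))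
  k-odd m j = begin
      k (suc (m * 2)) j
    ≡⟨ k-suc (m * 2) j ⟩
      next (parity (m * 2)) (k (m * 2)) j
    ≡⟨ cong (λ p → next p (k (m * 2)) j) (parity-*2 m) ⟩
      a (k (m * 2)) j
    ≡⟨ next-cong 0ℙ (k-even m) j ⟩
      a (caPow m (k 0)) j
    ∎

t-by-halves : ∀ i {r q} → i % 2 ≡ r → i / 2 ≡ q → t i ≡ (if r ≡ᵇ 0 then caPow q else a ∘ caPow q)
t-by-halves _ = cong₂ (λ r q → if r ≡ᵇ 0 then caPow q else a ∘ caPow q)

t-even : ∀ m → t (m * 2) ≡ caPow m
t-even m = t-by-halves (m * 2) (m*n%n≡0 m 2) (m*n/n≡m m 2)

t-odd : ∀ m → t (suc (m * 2)) ≡ a ∘ caPow m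
t-odd m = t-by-halves (suc (m * 2)) ([m+kn]%n≡m%n 1 m 2) ([m+kn]/n≡m/n+k 1 m 2)

mainTheorem6 : (i : ℕ) → k i ≗ t i (k 0)
mainTheorem6 i = subst (λ i → k i ≗ t i (k 0)) (sym (m≡m%n+[m/n]*n i 2)) (by-parity (i % 2) (m%n<n i 2))
  where
  by-parity : ∀ d → d < 2 → k (d + i / 2 * 2) ≗ t (d + i / 2 * 2) (k 0)
  by-parity 0 _ rewrite t-even (i / 2) = k-even (i / 2)
  by-parity 1 _ rewrite t-odd (i / 2) = k-odd (i / 2)
  by-parity (suc (suc _)) (s≤s (s≤s ()))
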